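{- Every finite group $G$ satisfies $\Delta[G]\ge \frac{1+\sqrt{4|G|+4|G_2|-3}}{2}$, where $G_2=\{g\in G: g^{ -1}=g\ne 1_G\}$ is the set of elements of order $2$ in $G$.
   Context: For a subset $A$ of a group $G$, a subset $B\subseteq G$ is a difference basis for $A$ if every $a\in A$ can be written as $a=xy^{ -1}$ with $x,y\in B$. The difference size $\Delta[A]$ is the smallest cardinality of a difference basis for $A$; $\Delta[G]$ is the difference size of the whole group. $1_G$ denotes the identity of $G$. -}

module Defs where

open import Algebra.Bundles using (Group)
open import Data.Nat using (ℕ; _≤_)
open import Data.Fin using (Fin)
open import Data.Fin.Subset using (Subset; _∈_; ∣_∣)
open import Data.Product using (_×_; ∃₂; ∃)
open import Function.Bundles using (Bijection)
open import Relation.Binary.PropositionalEquality as ≡ using (_≡_)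
open import Relation.Nullary using (¬_)

module _ {c ℓ} (G : Group c ℓ) where
  open Group G

  -- A finite group of order n: an enumeration of its elements,
  -- i.e. a bijection from Fin n onto the carrier setoid of G.
  Enumeration : ℕ → Set _
  Enumeration n = Bijection (≡.setoid (Fin n)) setoid

  module _ {n : ℕ} (e : Enumeration n) where
    private
      el : Fin n → Carrier
      el = Bijection.to e

    IsDifferenceBasis : Subset n → Set _
    IsDifferenceBasis B =
      ∀ (a : Carrier) → ∃₂ λ i j → i ∈ B × j ∈ B × a ≈ (el i ∙ el j ⁻¹)

    IsDifferenceSize : ℕ → Set _
    IsDifferenceSize k =
      (∃ λ B → IsDifferenceBasis B × ∣ B ∣ ≡ k)
      × (∀ B → IsDifferenceBasis B → k ≤ ∣ B ∣)

    IsOrderTwoSet : Subset n → Set _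
    IsOrderTwoSet S =
      ∀ i → (i ∈ S → (el i ⁻¹ ≈ el i × ¬ (el i ≈ ε)))
          × ((el i ⁻¹ ≈ el i × ¬ (el i ≈ ε)) → i ∈ S)

-- Let B be a difference basis with |B| = k. Every g ≠ 1 is x y⁻¹ for an ordered pair
-- x ≠ y in B; fix one such pair per g. An involution g = x y⁻¹ also equals g⁻¹ = y x⁻¹,
-- so we may give it the swapped pair as well. All these pairs are distinct: two chosen
-- pairs coincide only for the same g, and a swapped pair of g equal to a chosen pair
-- forces both to belong to g, whence x = y and g = 1. Counting ordered pairs of distinct
-- elements of B gives (|G| - 1) + |G₂| ≤ k (k - 1), i.e. 4|G| + 4|G₂| ≤ (2k - 1)² + 3.

module Submission where

open import Defs
open import Algebra.Bundles using (Group)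
open import Data.Nat using (ℕ; _≤_; _+_; _*_; _∸_; _^_)
open import Data.Fin.Subset using (Subset; ∣_∣)
open import Data.Product using (_×_)

open import Algebra.Properties.Group using (⁻¹-anti-homo-∙; ⁻¹-involutive)
open import Data.Empty using (⊥-elim)
open import Data.Fin using (Fin; zero; suc; combine; punchOut; splitAt)
open import Data.Fin.Properties
  using (suc-injective; combine-injective; punchOut-injective; injective⇒≤; +↔⊎; nonZeroIndex)
open import Data.Fin.Subset using (_∈_; inside; outside; ∁; ⁅_⁆)
open import Data.Fin.Subset.Properties using (x∈⁅x⁆; x∈∁p⇒x∉p; ∣∁p∣≡n∸∣p∣; ∣⁅x⁆∣≡1)
open import Data.Nat using (zero; suc; NonZero; z≤n; s≤s; >-nonZero⁻¹)
open import Data.Nat.Properties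
  using (+-monoˡ-≤; *-monoʳ-≤; *-distribˡ-+; m≤n+m∸n; module ≤-Reasoning)
open import Data.Nat.Tactic.RingSolver using (solve-∀)
open import Data.Product using (_,_; proj₁; proj₂)
open import Data.Sum using (_⊎_; inj₁; inj₂; [_,_]′)
open import Data.Vec.Base using (_∷_; here; there)
open import Function using (_∘_)
open import Function.Bundles using (Bijection; Injection)
open import Function.Properties.Inverse using (↔⇒↣)
open import Relation.Binary.PropositionalEquality
  using (_≡_; _≢_; refl; sym; trans; cong; cong₂; subst; ≢-sym)
open import Relation.Nullary using (¬_)

enumerate : ∀ {n} (p : Subset n) → Fin ∣ p ∣ → Fin n
enumerate (inside ∷ p) zero = zero
enumerate (inside ∷ p) (suc i) = suc (enumerate p i)
enumerate (outside ∷ p) i = suc (enumerate p i)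

enumerate-∈ : ∀ {n} (p : Subset n) i → enumerate p i ∈ p
enumerate-∈ (inside ∷ p) zero = here
enumerate-∈ (inside ∷ p) (suc i) = there (enumerate-∈ p i)
enumerate-∈ (outside ∷ p) i = there (enumerate-∈ p i)

enumerate-injective : ∀ {n} (p : Subset n) {i j} → enumerate p i ≡ enumerate p j → i ≡ j
enumerate-injective (inside ∷ p) {zero} {zero} _ = refl
enumerate-injective (inside ∷ p) {suc i} {suc j} eq =
  cong suc (enumerate-injective p (suc-injective eq))
enumerate-injective (outside ∷ p) eq = enumerate-injective p (suc-injective eq)

rank : ∀ {n} (p : Subset n) {i} → i ∈ p → Fin ∣ p ∣
rank (inside ∷ p) here = zero
rank (inside ∷ p) (there i∈p) = suc (rank p i∈p)
rank (outside ∷ p) (there i∈p) = rank p i∈p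

rank-injective : ∀ {n} (p : Subset n) {i j} (i∈p : i ∈ p) (j∈p : j ∈ p) →
                 rank p i∈p ≡ rank p j∈p → i ≡ j
rank-injective (inside ∷ p) here here _ = refl
rank-injective (inside ∷ p) (there i∈p) (there j∈p) eq =
  cong suc (rank-injective p i∈p j∈p (suc-injective eq))
rank-injective (outside ∷ p) (there i∈p) (there j∈p) eq =
  cong suc (rank-injective p i∈p j∈p eq)

encodeDistinct : ∀ {k} {i j : Fin (suc k)} → i ≢ j → Fin (suc k * k)
encodeDistinct {i = i} i≢j = combine i (punchOut i≢j)

encodeDistinct-injective : ∀ {k} {i j i′ j′ : Fin (suc k)} (i≢j : i ≢ j) (i′≢j′ : i′ ≢ j′) →
                           encodeDistinct i≢j ≡ encodeDistinct i′≢j′ → i ≡ i′ × j ≡ j′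
encodeDistinct-injective {i = i} {i′ = i′} i≢j i′≢j′ eq
  with combine-injective i (punchOut i≢j) i′ (punchOut i′≢j′) eq
... | refl , eq′ = refl , punchOut-injective i≢j i′≢j′ eq′

distinctPairs-injective⇒≤ : ∀ {m k} (f g : Fin m → Fin k) → (∀ x → f x ≢ g x) →
                            (∀ {x y} → f x ≡ f y → g x ≡ g y → x ≡ y) → m ≤ k * (k ∸ 1)
distinctPairs-injective⇒≤ {zero} f g _ _ = z≤n
distinctPairs-injective⇒≤ {suc m} {zero} f g _ _ with f zero
... | ()
distinctPairs-injective⇒≤ {suc m} {suc k} f g f≢g inj =
  injective⇒≤ {f = λ x → encodeDistinct (f≢g x)}
    (λ eq → let f≡ , g≡ = encodeDistinct-injective (f≢g _) (f≢g _) eq in inj f≡ g≡)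

distinctPairsIn-injective⇒≤ : ∀ {m n} (B : Subset n) (f g : Fin m → Fin n) →
                              (∀ x → f x ∈ B) → (∀ x → g x ∈ B) → (∀ x → f x ≢ g x) →
                              (∀ {x y} → f x ≡ f y → g x ≡ g y → x ≡ y) →
                              m ≤ ∣ B ∣ * (∣ B ∣ ∸ 1)
distinctPairsIn-injective⇒≤ B f g f∈B g∈B f≢g inj =
  distinctPairs-injective⇒≤ (rank B ∘ f∈B) (rank B ∘ g∈B)
    (λ x → f≢g x ∘ rank-injective B _ _)
    (λ f≡ g≡ → inj (rank-injective B _ _ f≡) (rank-injective B _ _ g≡))

[2k∸1]^2+3≡4*[1+k*[k∸1]] : ∀ k .{{_ : NonZero k}} → (2 * k ∸ 1) ^ 2 + 3 ≡ 4 * suc (k * (k ∸ 1))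
[2k∸1]^2+3≡4*[1+k*[k∸1]] (suc k) = polynomial k
  where
  -- The goal with x ^ 2 and 2 * suc k ∸ 1 unfolded, which is the form the solver accepts.
  polynomial : ∀ k → (k + (1 + k + 0)) * ((k + (1 + k + 0)) * 1) + 3 ≡ 4 * (1 + (1 + k) * k)
  polynomial = solve-∀

module EnumeratedGroup {c ℓ} (G : Group c ℓ) {n} (e : Enumeration G n) where
  open Group G renaming (refl to ≈-refl; sym to ≈-sym; trans to ≈-trans)
  open import Relation.Binary.Reasoning.Setoid setoid

  el : Fin n → Carrier
  el = Bijection.to e

  el-injective : ∀ {u v} → el u ≈ el v → u ≡ v
  el-injective = Bijection.injective e

  identityIndex : Fin n
  identityIndex = proj₁ (Bijection.surjective e ε)

  el-identityIndex : el identityIndex ≈ ε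
  el-identityIndex = proj₂ (Bijection.surjective e ε) refl

  ∈∁⁅identityIndex⁆⇒≉ε : ∀ {u} → u ∈ ∁ ⁅ identityIndex ⁆ → ¬ el u ≈ ε
  ∈∁⁅identityIndex⁆⇒≉ε {u} u∈ el-u≈ε = x∈∁p⇒x∉p u∈
    (subst (_∈ ⁅ identityIndex ⁆) (sym (el-injective (≈-trans el-u≈ε (≈-sym el-identityIndex))))
      (x∈⁅x⁆ identityIndex))

  module DifferenceBasis {B : Subset n} (basis : IsDifferenceBasis G e B) where

    left right : Fin n → Fin n
    left u = proj₁ (basis (el u))
    right u = proj₁ (proj₂ (basis (el u)))

    left∈B : ∀ u → left u ∈ B
    left∈B u = proj₁ (proj₂ (proj₂ (basis (el u))))

    right∈B : ∀ u → right u ∈ B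
    right∈B u = proj₁ (proj₂ (proj₂ (proj₂ (basis (el u)))))

    represents : ∀ u → el u ≈ el (left u) ∙ el (right u) ⁻¹
    represents u = proj₂ (proj₂ (proj₂ (proj₂ (basis (el u)))))

    NonZero∣B∣ : NonZero ∣ B ∣
    NonZero∣B∣ = nonZeroIndex (rank B (left∈B identityIndex))

    left≡right⇒≈ε : ∀ {u} → left u ≡ right u → el u ≈ ε
    left≡right⇒≈ε {u} l≡r = begin
      el u                           ≈⟨ represents u ⟩
      el (left u) ∙ el (right u) ⁻¹  ≡⟨ cong (λ w → el w ∙ el (right u) ⁻¹) l≡r ⟩
      el (right u) ∙ el (right u) ⁻¹ ≈⟨ inverseʳ _ ⟩
      ε                              ∎

    left≢right : ∀ {u} → ¬ el u ≈ ε → left u ≢ right u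
    left≢right el-u≉ε = el-u≉ε ∘ left≡right⇒≈ε

    representation-injective : ∀ {u v} → left u ≡ left v → right u ≡ right v → u ≡ v
    representation-injective {u} {v} l≡l r≡r = el-injective (begin
      el u                          ≈⟨ represents u ⟩
      el (left u) ∙ el (right u) ⁻¹ ≡⟨ cong₂ (λ a b → el a ∙ el b ⁻¹) l≡l r≡r ⟩
      el (left v) ∙ el (right v) ⁻¹ ≈⟨ represents v ⟨
      el v                          ∎)

    swapped-representation-injective : ∀ {u v} → el v ⁻¹ ≈ el v →
                                       left u ≡ right v → right u ≡ left v → u ≡ v
    swapped-representation-injective {u} {v} v⁻¹≈v l≡r r≡l = el-injective (begin
      el u                                ≈⟨ represents u ⟩
      el (left u) ∙ el (right u) ⁻¹       ≡⟨ cong₂ (λ a b → el a ∙ el b ⁻¹) l≡r r≡l ⟩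
      el (right v) ∙ el (left v) ⁻¹       ≈⟨ ∙-congʳ (⁻¹-involutive G _) ⟨
      el (right v) ⁻¹ ⁻¹ ∙ el (left v) ⁻¹ ≈⟨ ⁻¹-anti-homo-∙ G _ _ ⟨
      (el (left v) ∙ el (right v) ⁻¹) ⁻¹  ≈⟨ ⁻¹-cong (represents v) ⟨
      el v ⁻¹                             ≈⟨ v⁻¹≈v ⟩
      el v                                ∎)

    swapped-representation⇒≈ε : ∀ {u v} → el v ⁻¹ ≈ el v →
                               left u ≡ right v → right u ≡ left v → el u ≈ ε
    swapped-representation⇒≈ε v⁻¹≈v l≡r r≡l = left≡right⇒≈ε
      (trans l≡r (cong right (sym (swapped-representation-injective v⁻¹≈v l≡r r≡l))))

    nonIdentities+involutions≤ : (N S : Subset n) → (∀ {u} → u ∈ N → ¬ el u ≈ ε) →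
                                 (∀ {v} → v ∈ S → el v ⁻¹ ≈ el v × ¬ el v ≈ ε) →
                                 ∣ N ∣ + ∣ S ∣ ≤ ∣ B ∣ * (∣ B ∣ ∸ 1)
    nonIdentities+involutions≤ N S N≉ε S-involutive =
      distinctPairsIn-injective⇒≤ B (first ∘ split) (second ∘ split)
        (first∈B ∘ split) (second∈B ∘ split) (first≢second ∘ split)
        (λ f≡ s≡ → Injection.injective (↔⇒↣ +↔⊎) (pair-injective _ _ f≡ s≡))
      where
      split : Fin (∣ N ∣ + ∣ S ∣) → Fin ∣ N ∣ ⊎ Fin ∣ S ∣
      split = splitAt ∣ N ∣

      nonIdentity : Fin ∣ N ∣ → Fin n
      nonIdentity = enumerate N

      involution : Fin ∣ S ∣ → Fin n
      involution = enumerate S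

      nonIdentity≉ε : ∀ i → ¬ el (nonIdentity i) ≈ ε
      nonIdentity≉ε i = N≉ε (enumerate-∈ N i)

      involution⁻¹≈ : ∀ j → el (involution j) ⁻¹ ≈ el (involution j)
      involution⁻¹≈ j = proj₁ (S-involutive (enumerate-∈ S j))

      involution≉ε : ∀ j → ¬ el (involution j) ≈ ε
      involution≉ε j = proj₂ (S-involutive (enumerate-∈ S j))

      first second : Fin ∣ N ∣ ⊎ Fin ∣ S ∣ → Fin n
      first = [ left ∘ nonIdentity , right ∘ involution ]′
      second = [ right ∘ nonIdentity , left ∘ involution ]′

      first∈B : ∀ x → first x ∈ B
      first∈B (inj₁ i) = left∈B _
      first∈B (inj₂ j) = right∈B _

      second∈B : ∀ x → second x ∈ B
      second∈B (inj₁ i) = right∈B _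
      second∈B (inj₂ j) = left∈B _

      first≢second : ∀ x → first x ≢ second x
      first≢second (inj₁ i) = left≢right (nonIdentity≉ε i)
      first≢second (inj₂ j) = ≢-sym (left≢right (involution≉ε j))

      pair-injective : ∀ x y → first x ≡ first y → second x ≡ second y → x ≡ y
      pair-injective (inj₁ i) (inj₁ i′) l≡l r≡r =
        cong inj₁ (enumerate-injective N (representation-injective l≡l r≡r))
      pair-injective (inj₂ j) (inj₂ j′) r≡r l≡l =
        cong inj₂ (enumerate-injective S (representation-injective l≡l r≡r))
      pair-injective (inj₁ i) (inj₂ j) l≡r r≡l =
        ⊥-elim (nonIdentity≉ε i (swapped-representation⇒≈ε (involution⁻¹≈ j) l≡r r≡l))
      pair-injective (inj₂ j) (inj₁ i) r≡l l≡r =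
        ⊥-elim (nonIdentity≉ε i (swapped-representation⇒≈ε (involution⁻¹≈ j) (sym r≡l) (sym l≡r)))

corollary3p2 : ∀ {c ℓ} (G : Group c ℓ) (n : ℕ) (e : Enumeration G n)
    (S : Subset n) → IsOrderTwoSet G e S
    → (k : ℕ) → IsDifferenceSize G e k
    → (1 ≤ k) × (4 * n + 4 * ∣ S ∣ ≤ (2 * k ∸ 1) ^ 2 + 3)
corollary3p2 G n e S S-order2 .(∣ B ∣) ((B , basis , refl) , _) =
  >-nonZero⁻¹ ∣ B ∣ {{NonZero∣B∣}} , (begin
    4 * n + 4 * ∣ S ∣             ≡⟨ *-distribˡ-+ 4 n ∣ S ∣ ⟨
    4 * (n + ∣ S ∣)               ≤⟨ *-monoʳ-≤ 4 count ⟩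
    4 * suc (∣ B ∣ * (∣ B ∣ ∸ 1)) ≡⟨ [2k∸1]^2+3≡4*[1+k*[k∸1]] ∣ B ∣ {{NonZero∣B∣}} ⟨
    (2 * ∣ B ∣ ∸ 1) ^ 2 + 3       ∎)
  where
  open EnumeratedGroup G e
  open DifferenceBasis basis
  open ≤-Reasoning

  nonIdentities : Subset n
  nonIdentities = ∁ ⁅ identityIndex ⁆

  ∣nonIdentities∣≡n∸1 : ∣ nonIdentities ∣ ≡ n ∸ 1
  ∣nonIdentities∣≡n∸1 = trans (∣∁p∣≡n∸∣p∣ ⁅ identityIndex ⁆) (cong (n ∸_) (∣⁅x⁆∣≡1 identityIndex))

  count : n + ∣ S ∣ ≤ suc (∣ B ∣ * (∣ B ∣ ∸ 1))
  count = begin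
    n + ∣ S ∣                       ≤⟨ +-monoˡ-≤ ∣ S ∣ (m≤n+m∸n n 1) ⟩
    suc (n ∸ 1 + ∣ S ∣)             ≡⟨ cong (λ m → suc (m + ∣ S ∣)) ∣nonIdentities∣≡n∸1 ⟨
    suc (∣ nonIdentities ∣ + ∣ S ∣) ≤⟨ s≤s (nonIdentities+involutions≤ nonIdentities S
                                          ∈∁⁅identityIndex⁆⇒≉ε (λ {v} → proj₁ (S-order2 v))) ⟩
    suc (∣ B ∣ * (∣ B ∣ ∸ 1))       ∎
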